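{- Let $Y_1,\dots,Y_k$ be independent random variables with $Y_i\sim\mathrm{Bin}(m_i,\tfrac12)$ and $m_i\ge 1$ for every $i\in[k]$. Let $X=\sum_{i=1}^k\min\{Y_i,m_i-Y_i\}$ and $Z\sim\mathrm{Bin}\left(\sum_{i=1}^k\lfloor m_i/2\rfloor,\tfrac12\right)$. Then $X$ stochastically dominates $Z$, i.e., $\Pr[X\le s]\le\Pr[Z\le s]$ for every $s\ge 0$.
   Context: $\mathrm{Bin}(k,q)$ denotes the binomial distribution with $k$ trials and success probability $q$. -}

module Defs where

open import Data.Nat as ℕ using (ℕ; zero; suc; _∸_; _⊓_; _≤?_)
open import Data.Nat.Combinatorics using (_C_)
open import Data.Integer using (+_)
open import Data.Rational using (ℚ; 0ℚ; 1ℚ; ½; _+_; _*_; _/_)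
open import Data.Fin using (Fin; zero; suc)
open import Relation.Nullary using (yes; no)

½^ : ℕ → ℚ
½^ zero = 1ℚ
½^ (suc m) = ½ * ½^ m

binPmf : ℕ → ℕ → ℚ
binPmf m y = ((+ (m C y)) / 1) * ½^ m

sumUpTo : ℕ → (ℕ → ℚ) → ℚ
sumUpTo zero f = f zero
sumUpTo (suc n) f = sumUpTo n f + f (suc n)

-- Expectation of f(Y₁,…,Y_k) for independent Yᵢ ~ Bin(mᵢ, 1/2)
-- (sum over the product sample space, weighted by the product of pmfs).
expectIndep : (k : ℕ) → (m : Fin k → ℕ) → ((Fin k → ℕ) → ℚ) → ℚ
expectIndep zero m f = f (λ ())
expectIndep (suc k) m f =
  sumUpTo (m zero) λ y₀ →
    binPmf (m zero) y₀ *
      expectIndep k (λ i → m (suc i))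
        (λ ys → f (λ { zero → y₀ ; (suc i) → ys i }))

indLe : ℕ → ℕ → ℚ
indLe a s with a ≤? s
... | yes _ = 1ℚ
... | no _ = 0ℚ

sumFin : (k : ℕ) → (Fin k → ℕ) → ℕ
sumFin zero g = 0
sumFin (suc k) g = g zero ℕ.+ sumFin k (λ i → g (suc i))

Xval : (k : ℕ) → (m : Fin k → ℕ) → (Fin k → ℕ) → ℕ
Xval k m y = sumFin k (λ i → y i ⊓ (m i ∸ y i))

probXle : (k : ℕ) → (Fin k → ℕ) → ℕ → ℚ
probXle k m s = expectIndep k m (λ y → indLe (Xval k m y) s)

probBinLe : ℕ → ℕ → ℚ
probBinLe n s = sumUpTo n (λ j → binPmf n j * indLe j s)

-- Write 𝔼ₘ[f] for the expectation of f(Y) with Y ~ Bin(m, ½), and call a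
-- function H : ℕ → ℚ antitone when it is non-increasing.  Since the indicator
-- x ↦ [x ≤ s] is antitone, the theorem is the special case H = [· ≤ s] of
--
--     E[H(X)] ≤ 𝔼_N[H]   for every antitone H,   N = Σᵢ ⌊mᵢ/2⌋,
--
-- which we prove by induction on the number k of summands.  Three facts about
-- binomial expectations drive the induction:
--   * Pascal's rule   𝔼ₘ₊₁[f] = ½·𝔼ₘ[f] + ½·𝔼ₘ[f ∘ suc]   (Y ~ Bin(m+1) is Y' + B
--     with an independent fair coin B);
--   * the folding lemma  𝔼ₘ[H(min(Y, m − Y))] ≤ 𝔼_{⌊m/2⌋}[H]  for antitone H,
--     proved by induction m ↦ m + 2 using Pascal's rule twice;
--   * the convolution identity  𝔼ₙ[w ↦ 𝔼_N[j ↦ f(w + j)]] = 𝔼ₙ₊N[f], i.e.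
--     Bin(n) + Bin(N) ~ Bin(n + N) for independent summands.
-- In the induction step, the inner k variables are handled by the induction
-- hypothesis (applied to the shifted antitone function H(w + ·)), the first
-- variable by the folding lemma, and the two binomials are merged by convolution.

module Submission where

open import Defs
open import Data.Nat using (ℕ; _≤_; _/_)
open import Data.Fin using (Fin)
open import Data.Rational using () renaming (_≤_ to _≤ℚ_)

open import Data.Nat as ℕ using (zero; suc; _⊓_; _∸_; z≤n; s≤s; _≤?_)
import Data.Nat.Properties as ℕP
open import Data.Nat.DivMod using (m/n≡1+[m∸n]/n)
open import Data.Nat.Coprimality using (1-coprimeTo) renaming (sym to coprime-sym)
open import Data.Nat.Combinatorics using (_C_; nCk+nC[k+1]≡[n+1]C[k+1]; k>n⇒nCk≡0)
open import Data.Integer as ℤ using ()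
import Data.Integer.Properties as ℤP
open import Data.Rational as ℚ using (ℚ; 0ℚ; 1ℚ; ½; _+_; _*_)
import Data.Rational.Properties as ℚP
open import Data.Rational.Solver using (module +-*-Solver)
open import Relation.Binary.Definitions using (Antitonic₁)
open import Relation.Binary.PropositionalEquality using (_≡_; refl; sym; trans; cong; cong₂; module ≡-Reasoning)
open import Relation.Nullary using (yes; no; contradiction)

open +-*-Solver

-- The embedding ℕ → ℚ used by binPmf; it is additive, which turns Pascal's
-- rule for binomial coefficients into an identity between rationals.
ℕ→ℚ : ℕ → ℚ
ℕ→ℚ n = ℤ.+ n ℚ./ 1

ℕ→ℚ-+ : ∀ a b → ℕ→ℚ (a ℕ.+ b) ≡ ℕ→ℚ a + ℕ→ℚ b
ℕ→ℚ-+ a b = begin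
  ℕ→ℚ (a ℕ.+ b)
    ≡⟨ cong (ℚ._/ 1) (sym (cong₂ ℤ._+_ (ℤP.*-identityʳ (ℤ.+ a)) (ℤP.*-identityʳ (ℤ.+ b)))) ⟩
  (ℤ.+ a ℤ.* ℤ.+ 1 ℤ.+ ℤ.+ b ℤ.* ℤ.+ 1) ℚ./ 1
    ≡⟨ sym (cong₂ _+_ (asFraction a) (asFraction b)) ⟩
  ℕ→ℚ a + ℕ→ℚ b ∎
  where
  open ≡-Reasoning
  -- n/1 is already in lowest terms, so rational addition of such fractions
  -- reduces to integer addition of the numerators.
  asFraction : ∀ n → ℕ→ℚ n ≡ ℚ.mkℚ (ℤ.+ n) 0 (coprime-sym (1-coprimeTo n))
  asFraction n = ℚP.normalize-coprime (coprime-sym (1-coprimeTo n))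

ℕ→ℚ-nonNeg : ∀ n → 0ℚ ≤ℚ ℕ→ℚ n
ℕ→ℚ-nonNeg n = ℚP.nonNegative⁻¹ (ℕ→ℚ n) {{ℚP.normalize-nonNeg n 1}}

scale-mono : ∀ r {p q} → 0ℚ ≤ℚ r → p ≤ℚ q → r * p ≤ℚ r * q
scale-mono r 0≤r = ℚP.*-monoˡ-≤-nonNeg r {{ℚ.nonNegative 0≤r}}

nonNeg-* : ∀ {p q} → 0ℚ ≤ℚ p → 0ℚ ≤ℚ q → 0ℚ ≤ℚ p * q
nonNeg-* {p} 0≤p 0≤q = ℚP.≤-trans (ℚP.≤-reflexive (sym (ℚP.*-zeroʳ p))) (scale-mono p 0≤p 0≤q)

½-nonNeg : 0ℚ ≤ℚ ½
½-nonNeg = ℚP.nonNegative⁻¹ ½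

average-mono : ∀ {a b a′ b′} → a ≤ℚ a′ → b ≤ℚ b′ → ½ * a + ½ * b ≤ℚ ½ * a′ + ½ * b′
average-mono a≤a′ b≤b′ = ℚP.+-mono-≤ (scale-mono ½ ½-nonNeg a≤a′) (scale-mono ½ ½-nonNeg b≤b′)

binPmf-nonNeg : ∀ m y → 0ℚ ≤ℚ binPmf m y
binPmf-nonNeg m y = nonNeg-* (ℕ→ℚ-nonNeg (m C y)) (½^-nonNeg m)
  where
  ½^-nonNeg : ∀ m → 0ℚ ≤ℚ ½^ m
  ½^-nonNeg zero    = ℚP.nonNegative⁻¹ 1ℚ
  ½^-nonNeg (suc m) = nonNeg-* ½-nonNeg (½^-nonNeg m)

sum-cong : ∀ n {f g : ℕ → ℚ} → (∀ y → y ≤ n → f y ≡ g y) → sumUpTo n f ≡ sumUpTo n g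
sum-cong zero    f≡g = f≡g 0 z≤n
sum-cong (suc n) f≡g = cong₂ _+_ (sum-cong n (λ y y≤n → f≡g y (ℕP.m≤n⇒m≤1+n y≤n))) (f≡g (suc n) ℕP.≤-refl)

sum-mono : ∀ n {f g : ℕ → ℚ} → (∀ y → y ≤ n → f y ≤ℚ g y) → sumUpTo n f ≤ℚ sumUpTo n g
sum-mono zero    f≤g = f≤g 0 z≤n
sum-mono (suc n) f≤g = ℚP.+-mono-≤ (sum-mono n (λ y y≤n → f≤g y (ℕP.m≤n⇒m≤1+n y≤n))) (f≤g (suc n) ℕP.≤-refl)

sum-+ : ∀ n (f g : ℕ → ℚ) → sumUpTo n (λ y → f y + g y) ≡ sumUpTo n f + sumUpTo n g
sum-+ zero    f g = refl
sum-+ (suc n) f g = trans (cong (_+ (f (suc n) + g (suc n))) (sum-+ n f g))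
  (solve 4 (λ a b c d → (a :+ b) :+ (c :+ d) := (a :+ c) :+ (b :+ d)) refl
     (sumUpTo n f) (sumUpTo n g) (f (suc n)) (g (suc n)))

sum-* : ∀ n c (f : ℕ → ℚ) → sumUpTo n (λ y → c * f y) ≡ c * sumUpTo n f
sum-* zero    c f = refl
sum-* (suc n) c f = trans (cong (_+ (c * f (suc n))) (sum-* n c f))
  (sym (ℚP.*-distribˡ-+ c (sumUpTo n f) (f (suc n))))

sum-shift : ∀ n (f : ℕ → ℚ) → sumUpTo (suc n) f ≡ f 0 + sumUpTo n (λ y → f (suc y))
sum-shift zero    f = refl
sum-shift (suc n) f = trans (cong (_+ f (suc (suc n))) (sum-shift n f))
  (ℚP.+-assoc (f 0) (sumUpTo n (λ y → f (suc y))) (f (suc (suc n))))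

𝔼 : ℕ → (ℕ → ℚ) → ℚ
𝔼 m f = sumUpTo m (λ y → binPmf m y * f y)

𝔼-cong : ∀ m {f g : ℕ → ℚ} → (∀ y → y ≤ m → f y ≡ g y) → 𝔼 m f ≡ 𝔼 m g
𝔼-cong m f≡g = sum-cong m (λ y y≤m → cong (binPmf m y *_) (f≡g y y≤m))

𝔼-mono : ∀ m {f g : ℕ → ℚ} → (∀ y → y ≤ m → f y ≤ℚ g y) → 𝔼 m f ≤ℚ 𝔼 m g
𝔼-mono m f≤g = sum-mono m (λ y y≤m → scale-mono (binPmf m y) (binPmf-nonNeg m y) (f≤g y y≤m))

𝔼-zero : ∀ f → 𝔼 0 f ≡ f 0
𝔼-zero f = ℚP.*-identityˡ (f 0)

binom : ℕ → ℕ → ℚ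
binom n y = ℕ→ℚ (n C y)

binomial-sum-step : ∀ m (F : ℕ → ℚ) →
  sumUpTo (suc m) (λ y → binom (suc m) y * F y)
    ≡ sumUpTo m (λ y → binom m y * F y) + sumUpTo m (λ y → binom m y * F (suc y))
binomial-sum-step m F = begin
  sumUpTo (suc m) (λ y → binom (suc m) y * F y)
    ≡⟨ sum-shift m (λ y → binom (suc m) y * F y) ⟩
  X₀ + sumUpTo m (λ y → binom (suc m) (suc y) * F (suc y))
    ≡⟨ cong (X₀ +_) (sum-cong m (λ y _ → trans (cong (_* F (suc y)) (pascal y))
         (ℚP.*-distribʳ-+ (F (suc y)) (binom m y) (binom m (suc y))))) ⟩
  X₀ + sumUpTo m (λ y → binom m y * F (suc y) + binom m (suc y) * F (suc y))
    ≡⟨ cong (X₀ +_) (sum-+ m (λ y → binom m y * F (suc y)) (λ y → binom m (suc y) * F (suc y))) ⟩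
  X₀ + (A + B)
    ≡⟨ solve 3 (λ x a b → x :+ (a :+ b) := a :+ (x :+ b)) refl X₀ A B ⟩
  A + (X₀ + B)
    ≡⟨ cong (A +_) (sym (sum-shift m (λ y → binom m y * F y))) ⟩
  A + (S + binom m (suc m) * F (suc m))
    ≡⟨ cong (λ z → A + (S + ℕ→ℚ z * F (suc m))) (k>n⇒nCk≡0 (ℕP.n<1+n m)) ⟩
  A + (S + 0ℚ * F (suc m))
    ≡⟨ solve 3 (λ a s x → a :+ (s :+ con 0ℚ :* x) := s :+ a) refl A S (F (suc m)) ⟩
  S + A ∎
  where
  open ≡-Reasoning
  pascal : ∀ y → binom (suc m) (suc y) ≡ binom m y + binom m (suc y)
  pascal y = trans (cong ℕ→ℚ (sym (nCk+nC[k+1]≡[n+1]C[k+1] m y))) (ℕ→ℚ-+ (m C y) (m C suc y))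
  X₀ A B S : ℚ
  X₀ = binom (suc m) 0 * F 0
  A  = sumUpTo m (λ y → binom m y * F (suc y))
  B  = sumUpTo m (λ y → binom m (suc y) * F (suc y))
  S  = sumUpTo m (λ y → binom m y * F y)

-- Pascal's rule for expectations: Bin(m+1, ½) is Bin(m, ½) plus a fair coin.
𝔼-pascal : ∀ m (f : ℕ → ℚ) → 𝔼 (suc m) f ≡ ½ * 𝔼 m f + ½ * 𝔼 m (λ y → f (suc y))
𝔼-pascal m f = begin
  𝔼 (suc m) f
    ≡⟨ sum-cong (suc m) (λ y _ → ℚP.*-assoc (binom (suc m) y) (½ * ½^ m) (f y)) ⟩
  sumUpTo (suc m) (λ y → binom (suc m) y * (½ * ½^ m * f y))
    ≡⟨ binomial-sum-step m (λ y → ½ * ½^ m * f y) ⟩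
  sumUpTo m (λ y → binom m y * (½ * ½^ m * f y))
    + sumUpTo m (λ y → binom m y * (½ * ½^ m * f (suc y)))
    ≡⟨ cong₂ _+_ (pull-½ f) (pull-½ (λ y → f (suc y))) ⟩
  ½ * 𝔼 m f + ½ * 𝔼 m (λ y → f (suc y)) ∎
  where
  open ≡-Reasoning
  pull-½ : ∀ g → sumUpTo m (λ y → binom m y * (½ * ½^ m * g y)) ≡ ½ * 𝔼 m g
  pull-½ g = trans (sum-cong m (λ y _ →
      solve 4 (λ c h p x → c :* ((h :* p) :* x) := h :* ((c :* p) :* x)) refl (binom m y) ½ (½^ m) (g y)))
    (sum-* m ½ (λ y → binPmf m y * g y))

𝔼-convolution : ∀ n N (f : ℕ → ℚ) → 𝔼 n (λ w → 𝔼 N (λ j → f (w ℕ.+ j))) ≡ 𝔼 (n ℕ.+ N) f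
𝔼-convolution zero    N f = 𝔼-zero (λ w → 𝔼 N (λ j → f (w ℕ.+ j)))
𝔼-convolution (suc n) N f = begin
  𝔼 (suc n) (λ w → 𝔼 N (λ j → f (w ℕ.+ j)))
    ≡⟨ 𝔼-pascal n (λ w → 𝔼 N (λ j → f (w ℕ.+ j))) ⟩
  ½ * 𝔼 n (λ w → 𝔼 N (λ j → f (w ℕ.+ j))) + ½ * 𝔼 n (λ w → 𝔼 N (λ j → f (suc (w ℕ.+ j))))
    ≡⟨ cong₂ (λ u v → ½ * u + ½ * v) (𝔼-convolution n N f) (𝔼-convolution n N (λ x → f (suc x))) ⟩
  ½ * 𝔼 (n ℕ.+ N) f + ½ * 𝔼 (n ℕ.+ N) (λ x → f (suc x))
    ≡⟨ sym (𝔼-pascal (n ℕ.+ N) f) ⟩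
  𝔼 (suc n ℕ.+ N) f ∎
  where open ≡-Reasoning

Antitone : (ℕ → ℚ) → Set
Antitone = Antitonic₁ _≤_ _≤ℚ_

shift-antitone : ∀ {H} w → Antitone H → Antitone (λ x → H (w ℕ.+ x))
shift-antitone w anti y≤x = anti (ℕP.+-monoʳ-≤ w y≤x)

𝔼-shift-antitone : ∀ N {H} → Antitone H → Antitone (λ w → 𝔼 N (λ j → H (w ℕ.+ j)))
𝔼-shift-antitone N anti v≤w = 𝔼-mono N (λ j _ → anti (ℕP.+-monoˡ-≤ j v≤w))

indLe-antitone : ∀ s → Antitone (λ x → indLe x s)
indLe-antitone s {x} {y} y≤x with x ≤? s | y ≤? s
... | yes _   | yes _   = ℚP.≤-refl
... | yes x≤s | no  y≰s = contradiction (ℕP.≤-trans y≤x x≤s) y≰s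
... | no  _   | yes _   = ℚP.nonNegative⁻¹ 1ℚ
... | no  _   | no  _   = ℚP.≤-refl

fold : ℕ → ℕ → ℕ
fold m y = y ⊓ (m ∸ y)

fold-step : ∀ m y → y ≤ m → fold (suc (suc m)) (suc y) ≡ suc (fold m y)
fold-step m y y≤m = cong (suc y ⊓_) (ℕP.+-∸-assoc 1 y≤m)

fold-≤-left : ∀ m y → fold m y ≤ fold (suc (suc m)) y
fold-≤-left m y = ℕP.⊓-mono-≤ (ℕP.≤-refl {y}) (ℕP.∸-monoˡ-≤ y (ℕP.m≤n⇒m≤1+n (ℕP.n≤1+n m)))

fold-≤-right : ∀ m y → fold m y ≤ fold (suc (suc m)) (suc (suc y))
fold-≤-right m y = ℕP.⊓-mono-≤ (ℕP.m≤n⇒m≤1+n (ℕP.n≤1+n y)) (ℕP.≤-refl {m ∸ y})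

-- Expanding Bin(m+2) as Bin(m) plus two fair coins, the folded value is
-- exactly fold m Y + 1 when the coins differ and at least fold m Y when they
-- agree.  By antitonicity the expectation is at most the average of
-- E[H(fold m Y)] and E[H(fold m Y + 1)], which the induction hypothesis (for H
-- and for H ∘ suc) bounds by ½·𝔼_{⌊m/2⌋}[H] + ½·𝔼_{⌊m/2⌋}[H ∘ suc] = 𝔼_{⌊m/2⌋+1}[H].
fold-dominance : ∀ m H → Antitone H → 𝔼 m (λ y → H (fold m y)) ≤ℚ 𝔼 (m / 2) H
fold-dominance zero          H anti = ℚP.≤-refl
fold-dominance (suc zero)    H anti = ℚP.≤-reflexive (trans (𝔼-pascal 0 (λ y → H (fold 1 y)))
  (solve 1 (λ h → con ½ :* h :+ con ½ :* h := h) refl (𝔼 0 H)))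
fold-dominance (suc (suc m)) H anti = begin
  𝔼 (suc (suc m)) f
    ≡⟨ 𝔼-pascal (suc m) f ⟩
  ½ * 𝔼 (suc m) f + ½ * 𝔼 (suc m) (λ y → f (suc y))
    ≡⟨ cong₂ (λ u v → ½ * u + ½ * v) (𝔼-pascal m f) (𝔼-pascal m (λ y → f (suc y))) ⟩
  ½ * (½ * 𝔼 m f + ½ * 𝔼 m (λ y → f (suc y)))
    + ½ * (½ * 𝔼 m (λ y → f (suc y)) + ½ * 𝔼 m (λ y → f (suc (suc y))))
    ≤⟨ average-mono
         (average-mono (𝔼-mono m (λ y _ → anti (fold-≤-left m y)))
                       (ℚP.≤-reflexive (𝔼-cong m (λ y y≤m → cong H (fold-step m y y≤m)))))
         (average-mono (ℚP.≤-reflexive (𝔼-cong m (λ y y≤m → cong H (fold-step m y y≤m))))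
                       (𝔼-mono m (λ y _ → anti (fold-≤-right m y)))) ⟩
  ½ * (½ * a + ½ * b) + ½ * (½ * b + ½ * a)
    ≡⟨ solve 2 (λ a b → con ½ :* (con ½ :* a :+ con ½ :* b) :+ con ½ :* (con ½ :* b :+ con ½ :* a)
                    := con ½ :* a :+ con ½ :* b) refl a b ⟩
  ½ * a + ½ * b
    ≤⟨ average-mono (fold-dominance m H anti)
                    (fold-dominance m (λ w → H (suc w)) (λ y≤x → anti (s≤s y≤x))) ⟩
  ½ * 𝔼 (m / 2) H + ½ * 𝔼 (m / 2) (λ w → H (suc w))
    ≡⟨ sym (𝔼-pascal (m / 2) H) ⟩
  𝔼 (suc (m / 2)) H
    ≡⟨ cong (λ n → 𝔼 n H) (sym (m/n≡1+[m∸n]/n {suc (suc m)} {2} (s≤s (s≤s z≤n)))) ⟩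
  𝔼 (suc (suc m) / 2) H ∎
  where
  open ℚP.≤-Reasoning
  f : ℕ → ℚ
  f y = H (fold (suc (suc m)) y)
  a b : ℚ
  a = 𝔼 m (λ y → H (fold m y))
  b = 𝔼 m (λ y → H (suc (fold m y)))

-- The first variable is split off; by definition of
-- expectIndep and Xval the left-hand side is then 𝔼_{m₀}[y ↦ E[H(fold m₀ y + X′)]].
dominance : ∀ k (m : Fin k → ℕ) H → Antitone H →
  expectIndep k m (λ y → H (Xval k m y)) ≤ℚ 𝔼 (sumFin k (λ i → m i / 2)) H
dominance zero    m H anti = ℚP.≤-reflexive (sym (𝔼-zero H))
dominance (suc k) m H anti = begin
  𝔼 m₀ (λ y → expectIndep k m′ (λ ys → H (fold m₀ y ℕ.+ Xval k m′ ys)))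
    ≤⟨ 𝔼-mono m₀ (λ y _ → dominance k m′ (λ x → H (fold m₀ y ℕ.+ x)) (shift-antitone (fold m₀ y) anti)) ⟩
  𝔼 m₀ (λ y → 𝔼 N′ (λ j → H (fold m₀ y ℕ.+ j)))
    ≤⟨ fold-dominance m₀ (λ w → 𝔼 N′ (λ j → H (w ℕ.+ j))) (𝔼-shift-antitone N′ anti) ⟩
  𝔼 (m₀ / 2) (λ w → 𝔼 N′ (λ j → H (w ℕ.+ j)))
    ≡⟨ 𝔼-convolution (m₀ / 2) N′ H ⟩
  𝔼 (m₀ / 2 ℕ.+ N′) H ∎
  where
  open ℚP.≤-Reasoning
  m₀ : ℕ
  m₀ = m Fin.zero
  m′ : Fin k → ℕ
  m′ i = m (Fin.suc i)
  N′ : ℕ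
  N′ = sumFin k (λ i → m′ i / 2)

claim6p4 : (k : ℕ) (m : Fin k → ℕ) → (∀ i → 1 ≤ m i) →
    (s : ℕ) → probXle k m s ≤ℚ probBinLe (sumFin k (λ i → m i / 2)) s
claim6p4 k m _ s = dominance k m (λ x → indLe x s) (indLe-antitone s)
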